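{- Let $T$ be a tree with at least two vertices. Then $T$ has an interval coloring $\alpha$ such that $USE(V(T),\alpha)$ is continuous.
   Context: A proper edge-coloring $\alpha$ with consecutive integers $c_1,\ldots,c_t$ is an interval $t$-coloring if all $t$ colors are used and for every vertex $v$ the spectrum $S(v,\alpha)$ (set of colors on edges incident to $v$) is an interval of integers; an interval coloring is an interval $t$-coloring for some $t$. $\overline S(v,\alpha)=\max S(v,\alpha)$. $USE(V(T),\alpha)$ is the sequence of the numbers $\overline S(v,\alpha)$, $v\in V(T)$ (with multiplicity), arranged in nondecreasing order. A nondecreasing sequence of integers is continuous if it contains every integer between its smallest and largest element. -}

module Defs where

open import Data.Nat using (ℕ; _≤_; _⊔_)
open import Data.Bool using (Bool; true; false; T)
open import Data.Fin using (Fin)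
open import Data.List using (List; []; _∷_; _++_; length; map; foldr; filterᵇ; allFin)
open import Data.List.Relation.Unary.Linked using (Linked)
open import Data.List.Relation.Unary.Unique.Propositional using (Unique)
open import Data.Product using (Σ; ∃; _×_)
open import Relation.Nullary using (¬_)
open import Relation.Binary.PropositionalEquality using (_≡_; _≢_)

record SimpleGraph (n : ℕ) : Set where
  field
    adj    : Fin n → Fin n → Bool
    sym    : ∀ u v → adj u v ≡ adj v u
    irrefl : ∀ v → adj v v ≡ false

open SimpleGraph public

Adj : ∀ {n} → SimpleGraph n → Fin n → Fin n → Set
Adj G u v = T (adj G u v)

Connected : ∀ {n} → SimpleGraph n → Set
Connected {n} G = ∀ (u v : Fin n) →
  ∃ λ (xs : List (Fin n)) → Linked (Adj G) (u ∷ xs ++ v ∷ [])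

-- a cycle: distinct vertices u, x₁, …, xₖ, w (k ≥ 1, so at least 3 vertices),
-- consecutive ones adjacent, and w adjacent to u
HasCycle : ∀ {n} → SimpleGraph n → Set
HasCycle {n} G = ∃ λ (u : Fin n) → ∃ λ (xs : List (Fin n)) → ∃ λ (w : Fin n) →
  1 ≤ length xs × Unique (u ∷ xs ++ w ∷ []) ×
  Linked (Adj G) (u ∷ xs ++ w ∷ []) × Adj G w u

IsTree : ∀ {n} → SimpleGraph n → Set
IsTree G = Connected G × ¬ HasCycle G

-- An edge coloring assigns α u v to the edge uv; only values on edges matter.
EdgeColoring : ℕ → Set
EdgeColoring n = Fin n → Fin n → ℕ

InSpectrum : ∀ {n} → SimpleGraph n → EdgeColoring n → Fin n → ℕ → Set
InSpectrum G α v c = ∃ λ u → Adj G v u × α v u ≡ c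

IsIntervalColoring : ∀ {n} → SimpleGraph n → ℕ → EdgeColoring n → Set
IsIntervalColoring {n} G t α =
  -- well-defined on (undirected) edges
  (∀ u v → Adj G u v → α u v ≡ α v u) ×
  (∀ u v → Adj G u v → 1 ≤ α u v × α u v ≤ t) ×
  (∀ u v w → Adj G u v → Adj G u w → v ≢ w → α u v ≢ α u w) ×
  (∀ c → 1 ≤ c → c ≤ t → ∃ λ u → InSpectrum G α u c) ×
  (∀ v a b c → InSpectrum G α v a → InSpectrum G α v b → a ≤ c → c ≤ b →
     InSpectrum G α v c)

-- \overline S(v, α) = max S(v, α)  (0 for an isolated vertex; colors are ≥ 1)
maxSpectrum : ∀ {n} → SimpleGraph n → EdgeColoring n → Fin n → ℕ
maxSpectrum {n} G α v = foldr _⊔_ 0 (map (α v) (filterᵇ (adj G v) (allFin n)))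

USEContinuous : ∀ {n} → SimpleGraph n → EdgeColoring n → Set
USEContinuous {n} G α = ∀ (v w : Fin n) (c : ℕ) →
  maxSpectrum G α v ≤ c → c ≤ maxSpectrum G α w →
  ∃ λ x → maxSpectrum G α x ≡ c

module Submission where

-- Grow T from one edge by attaching one leaf at a time.  Along the
-- way we keep an interval t-colouring α of the current subtree with the extra
-- property that every colour c ∈ [1, t] is the SMALLEST colour at some vertex
-- (`MinWitnessed`).  A new leaf x hanging at u gets the colour hi(u) + 1,
-- where hi(u) is the largest colour at u: the spectrum of u stays an
-- interval, the spectrum of x is {hi(u) + 1}, acyclicity guarantees that u is
-- the only neighbour of x, and if hi(u) + 1 is a new colour then x is the
-- vertex where it is smallest.  Finally the reversal c ↦ t + 1 - c is again an
-- interval t-colouring, and turns smallest into largest colours: every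
-- c ∈ [1, t] is the largest colour somewhere, while all largest colours lie
-- in [1, t], so USE is continuous.

open import Defs renaming (sym to adj-sym; irrefl to adj-irrefl)
open import Data.Nat using (ℕ; zero; suc; _≤_; _<_; _⊔_; _∸_; _+_; z≤n; s≤s)
open import Data.Nat.Properties
open import Data.Bool using (T)
open import Data.Bool.Properties using (T?)
open import Data.Fin using (Fin; zero; suc)
import Data.Fin as F
open import Data.Fin.Properties using (pigeonhole)
open import Data.List using (List; []; _∷_; _++_; length; allFin; lookup)
open import Data.List.Properties using (foldr-preservesᵇ; foldr-preservesᵒ)
open import Data.List.Membership.Propositional using (_∈_; _∉_)
open import Data.List.Membership.Propositional.Properties using (∈-lookup; ∈-allFin; ∈-map⁺; ∈-filter⁺)
open import Data.List.Relation.Unary.Any using (here; there; any?; satisfied)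
import Data.List.Relation.Unary.Any as Any
open import Data.List.Relation.Unary.All using (All; []; _∷_)
import Data.List.Relation.Unary.All as All
import Data.List.Relation.Unary.All.Properties as AllP
open import Data.List.Relation.Unary.AllPairs using ([]; _∷_)
open import Data.List.Relation.Unary.Linked using (Linked; []; [-]; _∷_)
open import Data.List.Relation.Unary.Unique.Propositional using (Unique)
open import Data.Empty using (⊥-elim)
open import Data.Product using (Σ; ∃; _×_; _,_; proj₁; proj₂)
open import Data.Sum using (_⊎_; inj₁; inj₂; [_,_]′)
open import Function using (_∘_)
open import Relation.Nullary using (¬_; ¬?; Dec; yes; no)
open import Relation.Nullary.Decidable using (decidable-stable)
open import Relation.Binary.PropositionalEquality

module _ {n} (G : SimpleGraph n) (α : EdgeColoring n) where

  ≤-maxSpectrum : ∀ {v u} → Adj G v u → α v u ≤ maxSpectrum G α v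
  ≤-maxSpectrum {v} {u} vu = foldr-preservesᵒ {P = α v u ≤_} (λ x y → [ m≤n⇒m≤n⊔o y , m≤n⇒m≤o⊔n x ]′) 0 _
    (inj₂ (Any.map (λ { refl → ≤-refl }) (∈-map⁺ (α v) (∈-filter⁺ (T? ∘ adj G v) (∈-allFin u) vu))))

  maxSpectrum-≤ : ∀ {v m} → (∀ u → Adj G v u → α v u ≤ m) → maxSpectrum G α v ≤ m
  maxSpectrum-≤ {v} {m} bound = foldr-preservesᵇ {P = _≤ m} ⊔-lub z≤n
    (AllP.map⁺ (All.map (λ {u} → bound u) (AllP.all-filter (T? ∘ adj G v) (allFin n))))

-- Every colour c ∈ [1, t] is the smallest colour at some vertex.  Reversing
-- the colours turns this into the statement that USE is continuous.
MinWitnessed : ∀ {n} → SimpleGraph n → ℕ → EdgeColoring n → Set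
MinWitnessed G t α = ∀ c → 1 ≤ c → c ≤ t →
  ∃ λ x → InSpectrum G α x c × (∀ z → Adj G x z → c ≤ α x z)

reverse : ∀ {n} → ℕ → EdgeColoring n → EdgeColoring n
reverse t α u v = suc t ∸ α u v

reverse-involutive : ∀ {t c} → c ≤ suc t → suc t ∸ (suc t ∸ c) ≡ c
reverse-involutive = m∸[m∸n]≡n

reverse-range : ∀ {t c} → 1 ≤ c → c ≤ t → 1 ≤ suc t ∸ c × suc t ∸ c ≤ t
reverse-range {t} {c} 1≤c c≤t =
  subst (1 ≤_) (sym (+-∸-assoc 1 c≤t)) (s≤s z≤n) , ∸-monoʳ-≤ (suc t) 1≤c

module Reversal {n} (G : SimpleGraph n) (t : ℕ) (α : EdgeColoring n)
                (α-interval : IsIntervalColoring G t α) where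

  β : EdgeColoring n
  β = reverse t α

  private
    α-symmetric : ∀ u v → Adj G u v → α u v ≡ α v u
    α-symmetric = proj₁ α-interval

    α-range : ∀ u v → Adj G u v → 1 ≤ α u v × α u v ≤ t
    α-range = proj₁ (proj₂ α-interval)

    α-proper : ∀ u v w → Adj G u v → Adj G u w → v ≢ w → α u v ≢ α u w
    α-proper = proj₁ (proj₂ (proj₂ α-interval))

    α-used : ∀ c → 1 ≤ c → c ≤ t → ∃ λ u → InSpectrum G α u c
    α-used = proj₁ (proj₂ (proj₂ (proj₂ α-interval)))

    α-spectral : ∀ v a b c → InSpectrum G α v a → InSpectrum G α v b → a ≤ c → c ≤ b →
      InSpectrum G α v c
    α-spectral = proj₂ (proj₂ (proj₂ (proj₂ α-interval)))

  α≤suc-t : ∀ {u v} → Adj G u v → α u v ≤ suc t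
  α≤suc-t {u} {v} uv = m≤n⇒m≤1+n (proj₂ (α-range u v uv))

  to-α : ∀ {v c} → InSpectrum G β v c → InSpectrum G α v (suc t ∸ c)
  to-α {v} (z , vz , refl) = z , vz , sym (reverse-involutive (α≤suc-t vz))

  from-α : ∀ {v c} → InSpectrum G α v c → InSpectrum G β v (suc t ∸ c)
  from-α (z , vz , refl) = z , vz , refl

  β-spectrum-≤ : ∀ {v c} → InSpectrum G β v c → c ≤ suc t
  β-spectrum-≤ {v} (z , _ , refl) = m∸n≤m (suc t) (α v z)

  β-used : ∀ c → 1 ≤ c → c ≤ t → ∃ λ u → InSpectrum G β u c
  β-used c 1≤c c≤t with α-used (suc t ∸ c) (proj₁ (reverse-range 1≤c c≤t)) (proj₂ (reverse-range 1≤c c≤t))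
  ... | u , c∈Su = u , subst (InSpectrum G β u) (reverse-involutive (m≤n⇒m≤1+n c≤t)) (from-α c∈Su)

  β-spectral : ∀ v a b c → InSpectrum G β v a → InSpectrum G β v b → a ≤ c → c ≤ b →
    InSpectrum G β v c
  β-spectral v a b c a∈Sv b∈Sv a≤c c≤b =
    subst (InSpectrum G β v) (reverse-involutive (≤-trans c≤b (β-spectrum-≤ b∈Sv)))
      (from-α (α-spectral v (suc t ∸ b) (suc t ∸ a) (suc t ∸ c) (to-α b∈Sv) (to-α a∈Sv)
        (∸-monoʳ-≤ (suc t) c≤b) (∸-monoʳ-≤ (suc t) a≤c)))

  reverse-interval : IsIntervalColoring G t β
  reverse-interval =
      (λ u v uv → cong (suc t ∸_) (α-symmetric u v uv))
    , (λ u v uv → reverse-range (proj₁ (α-range u v uv)) (proj₂ (α-range u v uv)))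
    , (λ u v w uv uw v≢w eq → α-proper u v w uv uw v≢w (∸-cancelˡ-≡ (α≤suc-t uv) (α≤suc-t uw) eq))
    , β-used
    , β-spectral

  -- If every colour is a smallest colour somewhere and no vertex is isolated,
  -- the largest colours under β are exactly [1, t], so USE is continuous.
  reverse-continuous : MinWitnessed G t α → (∀ v → ∃ λ u → Adj G v u) → USEContinuous G β
  reverse-continuous minWitnessed neighbour v w c max[v]≤c c≤max[w] =
    x , ≤-antisym max[x]≤c c≤max[x]
    where
    β-range : ∀ u v → Adj G u v → 1 ≤ β u v × β u v ≤ t
    β-range = proj₁ (proj₂ reverse-interval)

    1≤c : 1 ≤ c
    1≤c = ≤-trans (proj₁ (β-range v _ (proj₂ (neighbour v))))
                  (≤-trans (≤-maxSpectrum G β (proj₂ (neighbour v))) max[v]≤c)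

    c≤t : c ≤ t
    c≤t = ≤-trans c≤max[w] (maxSpectrum-≤ G β (λ u wu → proj₂ (β-range w u wu)))

    witness : ∃ λ x → InSpectrum G α x (suc t ∸ c) × (∀ z → Adj G x z → suc t ∸ c ≤ α x z)
    witness = minWitnessed (suc t ∸ c) (proj₁ (reverse-range 1≤c c≤t)) (proj₂ (reverse-range 1≤c c≤t))

    x : Fin n
    x = proj₁ witness

    c∈Sx : InSpectrum G β x c
    c∈Sx = subst (InSpectrum G β x) (reverse-involutive (m≤n⇒m≤1+n c≤t)) (from-α (proj₁ (proj₂ witness)))

    max[x]≤c : maxSpectrum G β x ≤ c
    max[x]≤c = maxSpectrum-≤ G β (λ z xz →
      subst (suc t ∸ α x z ≤_) (reverse-involutive (m≤n⇒m≤1+n c≤t))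
        (∸-monoʳ-≤ (suc t) (proj₂ (proj₂ witness) z xz)))

    c≤max[x] : c ≤ maxSpectrum G β x
    c≤max[x] = subst (_≤ maxSpectrum G β x) (proj₂ (proj₂ c∈Sx)) (≤-maxSpectrum G β (proj₁ (proj₂ c∈Sx)))

linked-snoc : ∀ {A : Set} {R : A → A → Set} a ys b c →
  Linked R (a ∷ ys ++ b ∷ []) → R b c → Linked R (a ∷ (ys ++ b ∷ []) ++ c ∷ [])
linked-snoc a []       b c (ab ∷ [-]) bc = ab ∷ bc ∷ [-]
linked-snoc a (y ∷ ys) b c (ay ∷ l)   bc = ay ∷ linked-snoc y ys b c l bc

unique-snoc : ∀ {A : Set} (xs : List A) c → Unique xs → All (_≢ c) xs → Unique (xs ++ c ∷ [])
unique-snoc []       c []         []           = [] ∷ []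
unique-snoc (x ∷ xs) c (x∉ ∷ xs!) (x≢c ∷ xs≢c) = AllP.++⁺ x∉ (x≢c ∷ []) ∷ unique-snoc xs c xs! xs≢c

unique-cons : ∀ {A : Set} {x : A} xs → x ∉ xs → Unique xs → Unique (x ∷ xs)
unique-cons xs x∉xs xs! = All.tabulate (λ y∈xs x≡y → x∉xs (subst (_∈ xs) (sym x≡y) y∈xs)) ∷ xs!

first-step : ∀ {A : Set} {R : A → A → Set} u xs v → Linked R (u ∷ xs ++ v ∷ []) → ∃ λ a → R u a
first-step u []      v (uv ∷ [-]) = v , uv
first-step u (a ∷ _) v (ua ∷ _)   = a , ua

unique-length≤ : ∀ {n} (xs : List (Fin n)) → Unique xs → length xs ≤ n
unique-length≤ {n} xs xs! with length xs ≤? n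
... | yes ≤n = ≤n
... | no  ≰n with pigeonhole (≰⇒> ≰n) (lookup xs)
...   | i , j , i<j , same = ⊥-elim (distinct-positions xs! i j i<j same)
  where
  distinct-positions : ∀ {A : Set} {ys : List A} → Unique ys → ∀ i j → i F.< j → lookup ys i ≢ lookup ys j
  distinct-positions {ys = _ ∷ _} (y∉ ∷ _)   zero    (suc j) _         = All.lookup y∉ (∈-lookup j)
  distinct-positions {ys = _ ∷ _} (_ ∷ ys!) (suc i) (suc j) (s≤s i<j) = distinct-positions ys! i j i<j

module Growth {n} (G : SimpleGraph n) (connected : Connected G) (acyclic : ¬ HasCycle G) where
  open import Data.List.Membership.DecPropositional (F._≟_ {n}) using (_∈?_)

  adj-symmetric : ∀ {u v} → Adj G u v → Adj G v u
  adj-symmetric {u} {v} = subst T (adj-sym G u v)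

  no-loop : ∀ {v} → ¬ Adj G v v
  no-loop {v} = subst T (adj-irrefl G v)

  SpectrumIn : List (Fin n) → EdgeColoring n → Fin n → ℕ → Set
  SpectrumIn S α v c = ∃ λ z → z ∈ S × Adj G v z × α v z ≡ c

  PathIn : List (Fin n) → Fin n → Fin n → Set
  PathIn S u v = ∃ λ xs →
    All (_∈ S) (u ∷ xs ++ v ∷ []) × Unique (u ∷ xs ++ v ∷ []) × Linked (Adj G) (u ∷ xs ++ v ∷ [])

  record PartialColoring : Set where
    field
      S : List (Fin n)
      t : ℕ
      α : EdgeColoring n
      hi : Fin n → ℕ
      root : Fin n
      root∈S : root ∈ S
      S-unique : Unique S
      paths : ∀ u v → u ∈ S → v ∈ S → u ≢ v → PathIn S u v
      symmetric : ∀ u v → u ∈ S → v ∈ S → Adj G u v → α u v ≡ α v u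
      range : ∀ u v → u ∈ S → v ∈ S → Adj G u v → 1 ≤ α u v × α u v ≤ t
      proper : ∀ u v w → u ∈ S → v ∈ S → w ∈ S → Adj G u v → Adj G u w → v ≢ w → α u v ≢ α u w
      minWitness : ∀ c → 1 ≤ c → c ≤ t →
        ∃ λ x → x ∈ S × SpectrumIn S α x c × (∀ z → z ∈ S → Adj G x z → c ≤ α x z)
      spectral : ∀ v a b c → v ∈ S → SpectrumIn S α v a → SpectrumIn S α v b → a ≤ c → c ≤ b →
        SpectrumIn S α v c
      hi∈spectrum : ∀ v → v ∈ S → SpectrumIn S α v (hi v)
      hi-maximal : ∀ v z → v ∈ S → z ∈ S → Adj G v z → α v z ≤ hi v

  module Start (r a : Fin n) (ra : Adj G r a) where
    r≢a : r ≢ a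
    r≢a refl = no-loop ra

    S₀ : List (Fin n)
    S₀ = r ∷ a ∷ []

    α₀ : EdgeColoring n
    α₀ _ _ = 1

    paths₀ : ∀ u v → u ∈ S₀ → v ∈ S₀ → u ≢ v → PathIn S₀ u v
    paths₀ u v (here refl)         (here refl)         u≢v = ⊥-elim (u≢v refl)
    paths₀ u v (here refl)         (there (here refl)) _   =
      [] , (here refl ∷ there (here refl) ∷ []) , ((r≢a ∷ []) ∷ [] ∷ []) , (ra ∷ [-])
    paths₀ u v (there (here refl)) (here refl)         _   =
      [] , (there (here refl) ∷ here refl ∷ []) , (((r≢a ∘ sym) ∷ []) ∷ [] ∷ []) , (adj-symmetric ra ∷ [-])
    paths₀ u v (there (here refl)) (there (here refl)) u≢v = ⊥-elim (u≢v refl)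

    -- Inside S₀ every vertex has exactly one neighbour, so properness is about loops.
    proper₀ : ∀ u v w → u ∈ S₀ → v ∈ S₀ → w ∈ S₀ → Adj G u v → Adj G u w → v ≢ w → α₀ u v ≢ α₀ u w
    proper₀ u v w (here refl)         (here refl)         _                   uv _  _   _ = no-loop uv
    proper₀ u v w (here refl)         (there (here refl)) (here refl)         _  uw _   _ = no-loop uw
    proper₀ u v w (here refl)         (there (here refl)) (there (here refl)) _  _  v≢w _ = v≢w refl
    proper₀ u v w (there (here refl)) (there (here refl)) _                   uv _  _   _ = no-loop uv
    proper₀ u v w (there (here refl)) (here refl)         (there (here refl)) _  uw _   _ = no-loop uw
    proper₀ u v w (there (here refl)) (here refl)         (here refl)         _  _  v≢w _ = v≢w refl

    1∈spectrum : ∀ v → v ∈ S₀ → SpectrumIn S₀ α₀ v 1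
    1∈spectrum v (here refl)         = a , there (here refl) , ra , refl
    1∈spectrum v (there (here refl)) = r , here refl , adj-symmetric ra , refl

    start : PartialColoring
    start = record
      { S = S₀ ; t = 1 ; α = α₀ ; hi = λ _ → 1 ; root = r ; root∈S = here refl
      ; S-unique = (r≢a ∷ []) ∷ [] ∷ []
      ; paths = paths₀
      ; symmetric = λ _ _ _ _ _ → refl
      ; range = λ _ _ _ _ _ → ≤-refl , ≤-refl
      ; proper = proper₀
      ; minWitness = λ c 1≤c c≤1 → r , here refl ,
          subst (SpectrumIn S₀ α₀ r) (≤-antisym 1≤c c≤1) (1∈spectrum r (here refl)) , (λ _ _ _ → c≤1)
      ; spectral = λ { v _ _ c _ (z , z∈ , vz , refl) (_ , _ , _ , refl) a≤c c≤b →
          z , z∈ , vz , ≤-antisym a≤c c≤b }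
      ; hi∈spectrum = 1∈spectrum
      ; hi-maximal = λ _ _ _ _ _ → ≤-refl }

  module AddLeaf (P : PartialColoring) (u x : Fin n)
                 (u∈S : u ∈ PartialColoring.S P) (x∉S : x ∉ PartialColoring.S P) (ux : Adj G u x) where
    open PartialColoring P

    ≢x : ∀ {y} → y ∈ S → y ≢ x
    ≢x y∈S refl = x∉S y∈S

    all-≢x : ∀ {ys} → All (_∈ S) ys → All (_≢ x) ys
    all-≢x = All.map ≢x

    all-x≢ : ∀ {ys} → All (_∈ S) ys → All (x ≢_) ys
    all-x≢ = All.map (λ y∈S → ≢x y∈S ∘ sym)

    -- Acyclicity: x is adjacent to no vertex of S other than u, since a path
    -- from u to another such neighbour would close a cycle through x.
    only-neighbour : ∀ b → b ∈ S → Adj G x b → b ≡ u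
    only-neighbour b b∈S xb with b F.≟ u
    ... | yes b≡u = b≡u
    ... | no  b≢u with paths u b u∈S b∈S (b≢u ∘ sym)
    ...   | ys , ys∈S , ys! , walk =
      ⊥-elim (acyclic (x , u ∷ ys , b , s≤s z≤n ,
        (all-x≢ ys∈S ∷ ys!) , (adj-symmetric ux ∷ walk) , adj-symmetric xb))

    h : ℕ
    h = suc (hi u)

    α' : EdgeColoring n
    α' a b with a F.≟ x | b F.≟ x
    ... | yes _ | _     = h
    ... | no _  | yes _ = h
    ... | no _  | no _  = α a b

    α'-from-x : ∀ b → α' x b ≡ h
    α'-from-x b with x F.≟ x | b F.≟ x
    ... | yes _ | _ = refl
    ... | no x≢x | _ = ⊥-elim (x≢x refl)

    α'-to-x : ∀ a → α' a x ≡ h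
    α'-to-x a with a F.≟ x | x F.≟ x
    ... | yes _ | _      = refl
    ... | no _  | yes _  = refl
    ... | no _  | no x≢x = ⊥-elim (x≢x refl)

    α'-old : ∀ {a b} → a ∈ S → b ∈ S → α' a b ≡ α a b
    α'-old {a} {b} a∈S b∈S with a F.≟ x | b F.≟ x
    ... | yes a≡x | _       = ⊥-elim (≢x a∈S a≡x)
    ... | no _    | yes b≡x = ⊥-elim (≢x b∈S b≡x)
    ... | no _    | no _    = refl

    hi' : Fin n → ℕ
    hi' v with v F.≟ x | v F.≟ u
    ... | yes _ | _     = h
    ... | no _  | yes _ = h
    ... | no _  | no _  = hi v

    hi'-x : hi' x ≡ h
    hi'-x with x F.≟ x
    ... | yes _  = refl
    ... | no x≢x = ⊥-elim (x≢x refl)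

    hi'-u : hi' u ≡ h
    hi'-u with u F.≟ x | u F.≟ u
    ... | yes _ | _      = refl
    ... | no _  | yes _  = refl
    ... | no _  | no u≢u = ⊥-elim (u≢u refl)

    hi'-old : ∀ {v} → v ∈ S → v ≢ u → hi' v ≡ hi v
    hi'-old {v} v∈S v≢u with v F.≟ x | v F.≟ u
    ... | yes v≡x | _       = ⊥-elim (≢x v∈S v≡x)
    ... | no _    | yes v≡u = ⊥-elim (v≢u v≡u)
    ... | no _    | no _    = refl

    S' : List (Fin n)
    S' = x ∷ S

    t' : ℕ
    t' = t ⊔ h

    hi≤t : ∀ {v} → v ∈ S → hi v ≤ t
    hi≤t {v} v∈S with hi∈spectrum v v∈S
    ... | z , z∈S , vz , αvz≡hi = subst (_≤ t) αvz≡hi (proj₂ (range v z v∈S z∈S vz))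

    spectrum≤hi : ∀ {v b} → v ∈ S → SpectrumIn S α v b → b ≤ hi v
    spectrum≤hi {v} v∈S (z , z∈S , vz , refl) = hi-maximal v z v∈S z∈S vz

    α<h : ∀ w → w ∈ S → Adj G u w → α u w < h
    α<h w w∈S uw = s≤s (hi-maximal u w u∈S w∈S uw)

    neighbour-of-x : ∀ z → z ∈ S' → Adj G x z → z ≡ u
    neighbour-of-x z (here refl) xz = ⊥-elim (no-loop xz)
    neighbour-of-x z (there z∈S) xz = only-neighbour z z∈S xz

    spectrum-x : ∀ {c} → SpectrumIn S' α' x c → c ≡ h
    spectrum-x (z , _ , _ , refl) = α'-from-x z

    spectrum-restrict : ∀ {v c} → v ∈ S → SpectrumIn S' α' v c →
      SpectrumIn S α v c ⊎ (v ≡ u × c ≡ h)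
    spectrum-restrict {v} v∈S (z , here refl , vz , refl) =
      inj₂ (only-neighbour v v∈S (adj-symmetric vz) , α'-to-x v)
    spectrum-restrict {v} v∈S (z , there z∈S , vz , refl) = inj₁ (z , z∈S , vz , sym (α'-old v∈S z∈S))

    spectrum-lift : ∀ {v c} → v ∈ S → SpectrumIn S α v c → SpectrumIn S' α' v c
    spectrum-lift v∈S (z , z∈S , vz , refl) = z , there z∈S , vz , α'-old v∈S z∈S

    h∈spectrum-u : SpectrumIn S' α' u h
    h∈spectrum-u = x , here refl , ux , α'-to-x u

    h∈spectrum-x : SpectrumIn S' α' x h
    h∈spectrum-x = u , there u∈S , adj-symmetric ux , α'-from-x u

    -- Paths to x go through u.
    paths' : ∀ a b → a ∈ S' → b ∈ S' → a ≢ b → PathIn S' a b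
    paths' a b (here a≡x) (here b≡x) a≢b = ⊥-elim (a≢b (trans a≡x (sym b≡x)))
    paths' a b (here refl) (there b∈S) _ with b F.≟ u
    ... | yes refl = [] , (here refl ∷ there u∈S ∷ []) , (((≢x u∈S ∘ sym) ∷ []) ∷ [] ∷ []) , (adj-symmetric ux ∷ [-])
    ... | no b≢u with paths u b u∈S b∈S (b≢u ∘ sym)
    ...   | ys , ys∈S , ys! , walk =
      u ∷ ys , (here refl ∷ All.map there ys∈S) ,
      (all-x≢ ys∈S ∷ ys!) , (adj-symmetric ux ∷ walk)
    paths' a b (there a∈S) (here refl) _ with a F.≟ u
    ... | yes refl = [] , (there u∈S ∷ here refl ∷ []) , ((≢x u∈S ∷ []) ∷ [] ∷ []) , (ux ∷ [-])
    ... | no a≢u with paths a u a∈S u∈S a≢u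
    ...   | ys , ys∈S , ys! , walk =
      ys ++ u ∷ [] , AllP.++⁺ (All.map there ys∈S) (here refl ∷ []) ,
      unique-snoc (a ∷ ys ++ u ∷ []) x ys! (all-≢x ys∈S) , linked-snoc a ys u x walk ux
    paths' a b (there a∈S) (there b∈S) a≢b with paths a b a∈S b∈S a≢b
    ... | ys , ys∈S , ys! , walk = ys , All.map there ys∈S , ys! , walk

    symmetric' : ∀ a b → a ∈ S' → b ∈ S' → Adj G a b → α' a b ≡ α' b a
    symmetric' a b (here refl) _           _  = trans (α'-from-x b) (sym (α'-to-x b))
    symmetric' a b (there a∈S) (here refl) _  = trans (α'-to-x a) (sym (α'-from-x a))
    symmetric' a b (there a∈S) (there b∈S) ab = begin
      α' a b ≡⟨ α'-old a∈S b∈S ⟩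
      α a b  ≡⟨ symmetric a b a∈S b∈S ab ⟩
      α b a  ≡⟨ α'-old b∈S a∈S ⟨
      α' b a ∎
      where open ≡-Reasoning

    h-range : 1 ≤ h × h ≤ t'
    h-range = s≤s z≤n , m≤n⊔m t h

    range' : ∀ a b → a ∈ S' → b ∈ S' → Adj G a b → 1 ≤ α' a b × α' a b ≤ t'
    range' a b (here refl) _           _  rewrite α'-from-x b = h-range
    range' a b (there a∈S) (here refl) _  rewrite α'-to-x a   = h-range
    range' a b (there a∈S) (there b∈S) ab rewrite α'-old a∈S b∈S =
      proj₁ (range a b a∈S b∈S ab) , ≤-trans (proj₂ (range a b a∈S b∈S ab)) (m≤m⊔n t h)

    -- The only new edge at u has colour h, larger than every old colour at u.
    proper' : ∀ a v w → a ∈ S' → v ∈ S' → w ∈ S' → Adj G a v → Adj G a w → v ≢ w → α' a v ≢ α' a w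
    proper' a v w (here refl) v∈S' w∈S' av aw v≢w _ =
      v≢w (trans (neighbour-of-x v v∈S' av) (sym (neighbour-of-x w w∈S' aw)))
    proper' a v w (there a∈S) (here refl) (here refl) _ _ v≢w _ = v≢w refl
    proper' a v w (there a∈S) (here refl) (there w∈S) av aw _ same
      with only-neighbour a a∈S (adj-symmetric av)
    ... | refl rewrite α'-to-x a | α'-old a∈S w∈S = <-irrefl (sym same) (α<h w w∈S aw)
    proper' a v w (there a∈S) (there v∈S) (here refl) av aw _ same
      with only-neighbour a a∈S (adj-symmetric aw)
    ... | refl rewrite α'-to-x a | α'-old a∈S v∈S = <-irrefl same (α<h v v∈S av)
    proper' a v w (there a∈S) (there v∈S) (there w∈S) av aw v≢w
      rewrite α'-old a∈S v∈S | α'-old a∈S w∈S = proper a v w a∈S v∈S w∈S av aw v≢w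

    -- Old colours keep their old witnesses (the new edge at a witness is
    -- larger); a new colour must be h and is witnessed by x.
    minWitness' : ∀ c → 1 ≤ c → c ≤ t' →
      ∃ λ y → y ∈ S' × SpectrumIn S' α' y c × (∀ z → z ∈ S' → Adj G y z → c ≤ α' y z)
    minWitness' c 1≤c c≤t' with c ≤? t
    ... | yes c≤t with minWitness c 1≤c c≤t
    ...   | y , y∈S , c∈Sy , c-minimal = y , there y∈S , spectrum-lift y∈S c∈Sy , c-minimal'
      where
      c-minimal' : ∀ z → z ∈ S' → Adj G y z → c ≤ α' y z
      c-minimal' z (here refl) yz with only-neighbour y y∈S (adj-symmetric yz)
      ... | refl rewrite α'-to-x y = ≤-trans (spectrum≤hi y∈S c∈Sy) (n≤1+n (hi y))
      c-minimal' z (there z∈S) yz rewrite α'-old y∈S z∈S = c-minimal z z∈S yz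
    minWitness' c 1≤c c≤t' | no c≰t =
      x , here refl , subst (SpectrumIn S' α' x) (sym c≡h) h∈spectrum-x , c-minimal'
      where
      c≤h : c ≤ h
      c≤h with ⊔-sel t h
      ... | inj₁ t⊔h≡t = ⊥-elim (c≰t (subst (c ≤_) t⊔h≡t c≤t'))
      ... | inj₂ t⊔h≡h = subst (c ≤_) t⊔h≡h c≤t'
      c≡h : c ≡ h
      c≡h = ≤-antisym c≤h (≤-<-trans (hi≤t u∈S) (≰⇒> c≰t))
      c-minimal' : ∀ z → z ∈ S' → Adj G x z → c ≤ α' x z
      c-minimal' z _ _ rewrite α'-from-x z = c≤h

    -- The spectrum of u grows from [a, hi u] to [a, h].
    spectral' : ∀ v a b c → v ∈ S' → SpectrumIn S' α' v a → SpectrumIn S' α' v b → a ≤ c → c ≤ b →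
      SpectrumIn S' α' v c
    spectral' v a b c (here refl) a∈Sv b∈Sv a≤c c≤b =
      subst (SpectrumIn S' α' x)
        (sym (≤-antisym (subst (c ≤_) (spectrum-x b∈Sv) c≤b) (subst (_≤ c) (spectrum-x a∈Sv) a≤c)))
        h∈spectrum-x
    spectral' v a b c (there v∈S) a∈Sv b∈Sv a≤c c≤b
      with spectrum-restrict v∈S a∈Sv | spectrum-restrict v∈S b∈Sv
    ... | inj₁ a∈ | inj₁ b∈ = spectrum-lift v∈S (spectral v a b c v∈S a∈ b∈ a≤c c≤b)
    ... | inj₁ a∈ | inj₂ (refl , refl) with c ≟ h
    ...   | yes refl = h∈spectrum-u
    ...   | no  c≢h  = spectrum-lift v∈S
                         (spectral u a (hi u) c v∈S a∈ (hi∈spectrum u u∈S) a≤c (≤-pred (≤∧≢⇒< c≤b c≢h)))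
    spectral' v a b c (there v∈S) a∈Sv b∈Sv a≤c c≤b | inj₂ (refl , refl) | inj₁ b∈ =
      ⊥-elim (<-irrefl refl (≤-<-trans (≤-trans a≤c c≤b) (s≤s (spectrum≤hi v∈S b∈))))
    spectral' v a b c (there v∈S) a∈Sv b∈Sv a≤c c≤b | inj₂ (refl , refl) | inj₂ (_ , refl) =
      subst (SpectrumIn S' α' u) (≤-antisym a≤c c≤b) h∈spectrum-u

    hi∈spectrum-old : ∀ v → v ∈ S → Dec (v ≡ u) → SpectrumIn S' α' v (hi' v)
    hi∈spectrum-old v v∈S (yes refl) rewrite hi'-u = h∈spectrum-u
    hi∈spectrum-old v v∈S (no v≢u) rewrite hi'-old v∈S v≢u = spectrum-lift v∈S (hi∈spectrum v v∈S)

    hi∈spectrum' : ∀ v → v ∈ S' → SpectrumIn S' α' v (hi' v)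
    hi∈spectrum' v (here refl) rewrite hi'-x = h∈spectrum-x
    hi∈spectrum' v (there v∈S) = hi∈spectrum-old v v∈S (v F.≟ u)

    hi-maximal-old : ∀ v z → v ∈ S → z ∈ S' → Adj G v z → Dec (v ≡ u) → α' v z ≤ hi' v
    hi-maximal-old v z v∈S (here refl) vz (yes refl) rewrite α'-to-x u | hi'-u = ≤-refl
    hi-maximal-old v z v∈S (there z∈S) vz (yes refl) rewrite α'-old u∈S z∈S | hi'-u = <⇒≤ (α<h z z∈S vz)
    hi-maximal-old v z v∈S (here refl) vz (no v≢u) = ⊥-elim (v≢u (only-neighbour v v∈S (adj-symmetric vz)))
    hi-maximal-old v z v∈S (there z∈S) vz (no v≢u)
      rewrite α'-old v∈S z∈S | hi'-old v∈S v≢u = hi-maximal v z v∈S z∈S vz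

    hi-maximal' : ∀ v z → v ∈ S' → z ∈ S' → Adj G v z → α' v z ≤ hi' v
    hi-maximal' v z (here refl) _    _  rewrite α'-from-x z | hi'-x = ≤-refl
    hi-maximal' v z (there v∈S) z∈S' vz = hi-maximal-old v z v∈S z∈S' vz (v F.≟ u)

    extended : PartialColoring
    extended = record
      { S = S' ; t = t' ; α = α' ; hi = hi' ; root = root ; root∈S = there root∈S
      ; S-unique = unique-cons S x∉S S-unique
      ; paths = paths' ; symmetric = symmetric' ; range = range' ; proper = proper'
      ; minWitness = minWitness' ; spectral = spectral' ; hi∈spectrum = hi∈spectrum' ; hi-maximal = hi-maximal' }

  edge-leaving : ∀ (S : List (Fin n)) a xs y → a ∈ S → y ∉ S → Linked (Adj G) (a ∷ xs ++ y ∷ []) →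
    ∃ λ b → ∃ λ c → b ∈ S × c ∉ S × Adj G b c
  edge-leaving S a []       y a∈S y∉S (ay ∷ [-]) = a , y , a∈S , y∉S , ay
  edge-leaving S a (b ∷ xs) y a∈S y∉S (ab ∷ walk) with b ∈? S
  ... | yes b∈S = edge-leaving S b xs y b∈S y∉S walk
  ... | no  b∉S = a , b , a∈S , b∉S , ab

  Spans : PartialColoring → Set
  Spans P = ∀ v → v ∈ PartialColoring.S P

  module _ (P : PartialColoring) where
    open PartialColoring P

    spans-or-missing : Spans P ⊎ ∃ λ y → y ∉ S
    spans-or-missing with any? (λ v → ¬? (v ∈? S)) (allFin n)
    ... | yes some-missing = inj₂ (satisfied some-missing)
    ... | no  none-missing = inj₁ λ v →
      decidable-stable (v ∈? S) (λ v∉S → none-missing (Any.map (λ { refl → v∉S }) (∈-allFin v)))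

    boundary-edge : ∀ {y} → y ∉ S → ∃ λ b → ∃ λ c → b ∈ S × c ∉ S × Adj G b c
    boundary-edge {y} y∉S = let (xs , walk) = connected root y in edge-leaving S root xs y root∈S y∉S walk

    missing-bound : ∀ {c} → c ∉ S → suc (length S) ≤ n
    missing-bound c∉S = unique-length≤ (_ ∷ S) (unique-cons S c∉S S-unique)

  -- Attach leaves until S contains every vertex; the fuel k bounds the number
  -- of vertices still missing.
  grow : (k : ℕ) (P : PartialColoring) → n ≤ k + length (PartialColoring.S P) → Σ PartialColoring Spans
  grow k P n≤k+|S| with spans-or-missing P
  ... | inj₁ spans = P , spans
  ... | inj₂ (y , y∉S) with boundary-edge P y∉S
  ... | b , c , b∈S , c∉S , bc with k
  ... | zero  = ⊥-elim (<-irrefl refl (≤-trans (missing-bound P c∉S) n≤k+|S|))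
  ... | suc k = grow k (AddLeaf.extended P b c b∈S c∉S bc) (subst (n ≤_) (sym (+-suc k _)) n≤k+|S|)

  spanning-coloring : (r a : Fin n) → Adj G r a → Σ PartialColoring Spans
  spanning-coloring r a ra = grow n (Start.start r a ra) (m≤m+n n 2)

  module Spanning (P : PartialColoring) (spans : Spans P) where
    open PartialColoring P

    forget : ∀ {v c} → SpectrumIn S α v c → InSpectrum G α v c
    forget (z , _ , vz , eq) = z , vz , eq

    recall : ∀ {v c} → InSpectrum G α v c → SpectrumIn S α v c
    recall (z , vz , eq) = z , spans z , vz , eq

    interval : IsIntervalColoring G t α
    interval =
        (λ u v → symmetric u v (spans u) (spans v))
      , (λ u v → range u v (spans u) (spans v))
      , (λ u v w → proper u v w (spans u) (spans v) (spans w))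
      , (λ c 1≤c c≤t → let (y , _ , c∈Sy , _) = minWitness c 1≤c c≤t in y , forget c∈Sy)
      , (λ v a b c a∈Sv b∈Sv a≤c c≤b → forget (spectral v a b c (spans v) (recall a∈Sv) (recall b∈Sv) a≤c c≤b))

    min-witnessed : MinWitnessed G t α
    min-witnessed c 1≤c c≤t =
      let (y , _ , c∈Sy , c-minimal) = minWitness c 1≤c c≤t in y , forget c∈Sy , λ z → c-minimal z (spans z)

    has-neighbour : ∀ v → ∃ λ u → Adj G v u
    has-neighbour v = let (u , _ , vu , _) = hi∈spectrum v (spans v) in u , vu

theorem9 : ∀ (n : ℕ) → 2 ≤ n → (T : SimpleGraph n) → IsTree T →
    ∃ λ (t : ℕ) → ∃ λ (α : EdgeColoring n) →
    IsIntervalColoring T t α × USEContinuous T α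
theorem9 (suc zero) (s≤s ()) _ _
theorem9 (suc (suc m)) _ T (connected , acyclic) =
  t , β , reverse-interval , reverse-continuous min-witnessed has-neighbour
  where
  open Growth T connected acyclic
  edge : ∃ λ a → Adj T zero a
  edge = let (xs , walk) = connected zero (suc zero) in first-step zero xs (suc zero) walk

  spanning : Σ PartialColoring Spans
  spanning = spanning-coloring zero (proj₁ edge) (proj₂ edge)

  open PartialColoring (proj₁ spanning) using (t; α)
  open Spanning (proj₁ spanning) (proj₂ spanning)
  open Reversal T t α interval
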